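{- Let $n\geq 1$ and let $\vec{v}=(v_1,\ldots,v_n)\in\mathbb{N}_b^n$. For $1\leq i\leq n$ let $q_i$ be the number of indices $j$ with $v_j=i$. Then there exists a unique complete parenthesization of the word $x_1x_2\cdots x_{n+1}$ in which, for each $1\leq i\leq n$, exactly $q_i$ left parentheses immediately precede $x_i$ (and none precede $x_{n+1}$); that is, the string $(^{q_1}x_1(^{q_2}x_2\cdots(^{q_n}x_nx_{n+1}$ of letters and left parentheses can be completed by inserting right parentheses into a complete parenthesization in exactly one way. Denoting by $\mathrm{Tree}(\vec{v})\in Y_n$ the corresponding planar rooted binary tree, the map $\mathrm{Tree}:\mathbb{N}_b^n\to Y_n$ is surjective.
   Context: $\mathbb{N}_b^n:=\{(v_1,\ldots,v_n)\in\mathbb{N}^n:\ 0<v_i\leq i \text{ for all } i\}$. For $n\geq 0$, $Y_n$ is the set of planar rooted binary trees with $n$ internal (trivalent) vertices and $n+1$ leaves, considered up to isotopy. Such trees correspond bijectively to complete parenthesizations of $x_1\cdots x_{n+1}$, where every product of two factors $A,B$ is written $(AB)$, so that a tree in $Y_n$ ($n\geq1$) gives a parenthesization with exactly $n$ pairs of parentheses (e.g. $Y_1$ consists of $(x_1x_2)$, $Y_2$ of $((x_1x_2)x_3)$ and $(x_1(x_2x_3))$). -}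

module Defs where

open import Data.Nat using (ℕ; zero; suc; _+_; _≤_; _<_; _≟_)
open import Data.Fin using (Fin; toℕ)
open import Data.Vec using (Vec; lookup; toList)
open import Data.List using (List; []; _∷_; _++_; map; applyUpTo)
open import Relation.Nullary using (yes; no)

-- Y n : planar rooted binary trees with n internal vertices (n+1 leaves),
-- as a free inductive type (structural equality = isotopy).
data Y : ℕ → Set where
  leaf : Y 0
  node : ∀ {m k} → Y m → Y k → Y (suc (m + k))

-- ℕ_b^n : v ∈ ℕ^n with 0 < v_i ≤ i (1-based i; here index i : Fin n is 0-based)
InNb : ∀ {n} → Vec ℕ n → Set
InNb {n} v = (i : Fin n) → (0 < lookup v i) × (lookup v i ≤ suc (toℕ i))
  where open import Data.Product using (_×_)

countEq : ℕ → List ℕ → ℕ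
countEq a [] = 0
countEq a (x ∷ xs) with a ≟ x
... | yes _ = suc (countEq a xs)
... | no  _ = countEq a xs

qs : ∀ {n} → Vec ℕ n → List ℕ
qs {n} v = map (λ i → countEq i (toList v)) (applyUpTo suc n)

-- In the complete parenthesization of x_1 … x_{m+1} given by a tree,
-- the list whose i-th entry is the number of left parentheses immediately
-- preceding x_i.  A product (A B) contributes one '(' right before the
-- first character of A.
leftParens : ∀ {n} → Y n → List ℕ
leftParens leaf = 0 ∷ []
leftParens (node a b) with leftParens a
... | []      = leftParens b   -- impossible: leftParens is never empty
... | p ∷ ps  = (suc p ∷ ps) ++ leftParens b

{-# OPTIONS --safe #-}
-- Read the counts q₁ … q_{n+1} from the left, keeping a counter of the trees still to be
-- built: a leaf preceded by y left parentheses completes one tree and opens y right factors.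
-- A sequence is the code of a tree exactly when this counter stays positive and ends at 0
-- (Ballot 1), i.e. q₁ + ⋯ + q_j ≥ j for j ≤ n; the tree is then rebuilt greedily as left
-- combs, and it is unique because tree codes form a prefix code.  For v ∈ ℕ_b^n the sum
-- q₁ + ⋯ + q_j counts the v_i ≤ j, among them v₁, …, v_j, so the condition holds.  Conversely
-- a ballot sequence is the count vector of the sorted word 1^{q₁} 2^{q₂} ⋯ n^{q_n}, whose
-- i-th letter is at most i.
module Submission where

open import Defs
open import Data.Nat using (ℕ; _≤_)
open import Data.Vec using (Vec)
open import Data.List using (List; []; _∷_; _++_)
open import Data.Product using (Σ; _×_; ∃; ∃!)
open import Relation.Binary.PropositionalEquality using (_≡_)

open import Data.Nat using (zero; suc; _+_; _∸_; _<_; z≤n; s≤s; _≟_)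
open import Data.Nat.Properties
open import Data.Nat.ListAction using (sum)
open import Data.List using (length; map; replicate; applyUpTo)
open import Data.List.Properties using (length-++; length-replicate; ++-assoc; ++-identityʳ; ∷-injective; length-map; length-applyUpTo)
open import Data.Vec using ([]; _∷_; toList; fromList; lookup)
open import Data.Vec.Properties using (length-toList; toList∘fromList)
open import Data.Fin using (toℕ) renaming (zero to fzero; suc to fsuc)
open import Data.Product using (_,_; proj₁; proj₂; map₂)
open import Data.Sum using (inj₁; inj₂)
open import Data.Unit using (⊤; tt)
open import Data.Empty using (⊥)
open import Relation.Binary.PropositionalEquality using (refl; sym; trans; cong; cong₂; subst; _≢_; module ≡-Reasoning)
open import Relation.Nullary using (yes; no; contradiction)
open ≡-Reasoning

length-∷ʳ : ∀ {A : Set} (xs : List A) {x} → length (xs ++ x ∷ []) ≡ suc (length xs)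
length-∷ʳ [] = refl
length-∷ʳ (_ ∷ xs) = cong suc (length-∷ʳ xs)

incAt : ℕ → List ℕ → List ℕ
incAt i [] = []
incAt zero (x ∷ xs) = suc x ∷ xs
incAt (suc i) (x ∷ xs) = x ∷ incAt i xs

length-incAt : ∀ i xs → length (incAt i xs) ≡ length xs
length-incAt i [] = refl
length-incAt zero (x ∷ xs) = refl
length-incAt (suc i) (x ∷ xs) = cong suc (length-incAt i xs)

incAt-++ˡ : ∀ {i} xs ys → i < length xs → incAt i (xs ++ ys) ≡ incAt i xs ++ ys
incAt-++ˡ {zero} (x ∷ xs) ys _ = refl
incAt-++ˡ {suc i} (x ∷ xs) ys (s≤s i<n) = cong (x ∷_) (incAt-++ˡ xs ys i<n)

incAt-injective : ∀ i {xs ys} → incAt i xs ≡ incAt i ys → xs ≡ ys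
incAt-injective i {[]} {[]} _ = refl
incAt-injective zero {[]} {_ ∷ _} ()
incAt-injective (suc i) {[]} {_ ∷ _} ()
incAt-injective zero {_ ∷ _} {[]} ()
incAt-injective (suc i) {_ ∷ _} {[]} ()
incAt-injective zero {_ ∷ _} {_ ∷ _} refl = refl
incAt-injective (suc i) {x ∷ _} {_ ∷ _} eq with refl , eq′ ← ∷-injective eq =
  cong (x ∷_) (incAt-injective i eq′)

incAt-0≢0∷ : ∀ xs {ys} → incAt 0 xs ≢ 0 ∷ ys
incAt-0≢0∷ [] ()
incAt-0≢0∷ (_ ∷ _) ()

Tree : Set
Tree = Σ ℕ Y

leftParens-node : ∀ {m k} (a : Y m) (b : Y k) →
  leftParens (node a b) ≡ incAt 0 (leftParens a) ++ leftParens b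
leftParens-node a b with leftParens a
... | [] = refl
... | _ ∷ _ = refl

length-leftParens : ∀ {m} (t : Y m) → length (leftParens t) ≡ suc m
length-leftParens leaf = refl
length-leftParens (node {m} {k} a b) = begin
  length (leftParens (node a b))
    ≡⟨ cong length (leftParens-node a b) ⟩
  length (incAt 0 (leftParens a) ++ leftParens b)
    ≡⟨ length-++ (incAt 0 (leftParens a)) ⟩
  length (incAt 0 (leftParens a)) + length (leftParens b)
    ≡⟨ cong₂ _+_ (trans (length-incAt 0 (leftParens a)) (length-leftParens a)) (length-leftParens b) ⟩
  suc m + suc k
    ≡⟨ cong suc (+-suc m k) ⟩
  suc (suc (m + k)) ∎

leftParens-node-++ : ∀ {m k} (a : Y m) (b : Y k) r →
  leftParens (node a b) ++ r ≡ incAt 0 (leftParens a ++ leftParens b ++ r)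
leftParens-node-++ a b r = begin
  leftParens (node a b) ++ r
    ≡⟨ cong (_++ r) (leftParens-node a b) ⟩
  (incAt 0 (leftParens a) ++ leftParens b) ++ r
    ≡⟨ ++-assoc (incAt 0 (leftParens a)) (leftParens b) r ⟩
  incAt 0 (leftParens a) ++ leftParens b ++ r
    ≡⟨ incAt-++ˡ (leftParens a) _ (subst (0 <_) (sym (length-leftParens a)) (s≤s z≤n)) ⟨
  incAt 0 (leftParens a ++ leftParens b ++ r) ∎

leftParens-∷ʳ-0 : ∀ {m} (t : Y m) → ∃ λ q → leftParens t ≡ q ++ 0 ∷ []
leftParens-∷ʳ-0 leaf = [] , refl
leftParens-∷ʳ-0 (node a b) with q , eq ← leftParens-∷ʳ-0 b =
  incAt 0 (leftParens a) ++ q , (begin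
    leftParens (node a b)                    ≡⟨ leftParens-node a b ⟩
    incAt 0 (leftParens a) ++ leftParens b   ≡⟨ cong (incAt 0 (leftParens a) ++_) eq ⟩
    incAt 0 (leftParens a) ++ q ++ 0 ∷ []    ≡⟨ ++-assoc (incAt 0 (leftParens a)) q _ ⟨
    (incAt 0 (leftParens a) ++ q) ++ 0 ∷ []  ∎)

leftParens-prefix : ∀ {m m′} (t : Y m) (t′ : Y m′) {r r′} →
  leftParens t ++ r ≡ leftParens t′ ++ r′ → _≡_ {A = Tree} (m , t) (m′ , t′) × r ≡ r′
leftParens-prefix leaf leaf refl = refl , refl
leftParens-prefix leaf (node a′ b′) {r′ = r′} eq =
  contradiction (trans (sym (leftParens-node-++ a′ b′ r′)) (sym eq)) (incAt-0≢0∷ _)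
leftParens-prefix (node a b) leaf {r} eq =
  contradiction (trans (sym (leftParens-node-++ a b r)) eq) (incAt-0≢0∷ _)
leftParens-prefix (node a b) (node a′ b′) {r} {r′} eq
  with refl , eq₁ ← leftParens-prefix a a′ (incAt-injective 0 (begin
         incAt 0 (leftParens a ++ leftParens b ++ r)     ≡⟨ leftParens-node-++ a b r ⟨
         leftParens (node a b) ++ r                      ≡⟨ eq ⟩
         leftParens (node a′ b′) ++ r′                   ≡⟨ leftParens-node-++ a′ b′ r′ ⟩
         incAt 0 (leftParens a′ ++ leftParens b′ ++ r′)  ∎))
  with refl , eq₂ ← leftParens-prefix b b′ eq₁ = refl , eq₂

leftParens-injective : ∀ {n} {t t′ : Y n} → leftParens t ≡ leftParens t′ → t ≡ t′
leftParens-injective {t = t} {t′} eq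
  with refl , _ ← leftParens-prefix t t′ {[]} {[]} (cong (_++ []) eq) = refl

-- Ballot k q: q is the code of a forest of k trees, k counting the trees not yet read.
-- Equivalently q₁ + ⋯ + q_j ≥ j + 1 − k for j < length q, and k + sum q ≡ length q.
Ballot : ℕ → List ℕ → Set
Ballot k [] = k ≡ 0
Ballot zero (_ ∷ _) = ⊥
Ballot (suc k) (y ∷ q) = Ballot (y + k) q

ballot-incAt : ∀ {k} q {i} → i < k → Ballot (suc k) q → Ballot k (incAt i q)
ballot-incAt [] _ ()
ballot-incAt {zero} (_ ∷ _) ()
ballot-incAt {suc k} (y ∷ q) {zero} _ bal = subst (λ k′ → Ballot k′ q) (+-suc y k) bal
ballot-incAt {suc k} (y ∷ q) {suc i} (s≤s i<k) bal =
  ballot-incAt q (≤-trans i<k (m≤n+m k y)) (subst (λ k′ → Ballot k′ q) (+-suc y k) bal)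

ballot-sum : ∀ {k} q → Ballot k q → k + sum q ≡ length q
ballot-sum [] refl = refl
ballot-sum {zero} (_ ∷ _) ()
ballot-sum {suc k} (y ∷ q) bal = cong suc (begin
  k + (y + sum q)  ≡⟨ +-assoc k y (sum q) ⟨
  k + y + sum q    ≡⟨ cong (_+ sum q) (+-comm k y) ⟩
  y + k + sum q    ≡⟨ ballot-sum q bal ⟩
  length q         ∎)

ballot-leftParens : ∀ {m k} (t : Y m) {r} → Ballot k r → Ballot (suc k) (leftParens t ++ r)
ballot-leftParens leaf bal = bal
ballot-leftParens {k = k} (node a b) {r} bal =
  subst (Ballot (suc k)) (sym (leftParens-node-++ a b r))
    (ballot-incAt (leftParens a ++ leftParens b ++ r) (s≤s z≤n)
      (ballot-leftParens a (ballot-leftParens b bal)))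

forestParens : ∀ {k} → Vec Tree k → List ℕ
forestParens [] = []
forestParens ((_ , t) ∷ F) = leftParens t ++ forestParens F

graft : Tree → Tree → Tree
graft (m , a) (k , b) = suc (m + k) , node a b

-- The y left parentheses in front of t close after u₁, …, u_y in turn: (⋯((t u₁) u₂) ⋯ u_y).
leftComb : ∀ {k} y → Tree → Vec Tree (y + k) → Vec Tree (suc k)
leftComb zero t F = t ∷ F
leftComb (suc y) t (u ∷ F) = leftComb y (graft t u) F

forestParens-leftComb : ∀ {k} y t (F : Vec Tree (y + k)) {p xs} →
  leftParens (proj₂ t) ++ forestParens F ≡ p ∷ xs →
  forestParens (leftComb y t F) ≡ (y + p) ∷ xs
forestParens-leftComb zero t F eq = eq
forestParens-leftComb (suc y) (_ , a) ((_ , b) ∷ F) {p} {xs} eq =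
  trans (forestParens-leftComb y (graft (_ , a) (_ , b)) F
          (trans (leftParens-node-++ a b (forestParens F)) (cong (incAt 0) eq)))
        (cong (_∷ xs) (+-suc y p))

ballot⇒forest : ∀ {k} q → Ballot k q → Σ (Vec Tree k) λ F → forestParens F ≡ q
ballot⇒forest {zero} [] _ = [] , refl
ballot⇒forest {suc k} [] ()
ballot⇒forest {zero} (_ ∷ _) ()
ballot⇒forest {suc k} (y ∷ q) bal with F , eq ← ballot⇒forest q bal =
  leftComb y (0 , leaf) F ,
  trans (forestParens-leftComb y (0 , leaf) F (cong (0 ∷_) eq)) (cong (_∷ q) (+-identityʳ y))

ballot⇒tree : ∀ {n} q → Ballot 1 q → length q ≡ suc n → Σ (Y n) λ t → leftParens t ≡ q
ballot⇒tree q bal len with (_ , t) ∷ [] , eq ← ballot⇒forest q bal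
  with lp≡q ← trans (sym (++-identityʳ (leftParens t))) eq
  with refl ← suc-injective (trans (sym (length-leftParens t)) (trans (cong length lp≡q) len)) =
  t , lp≡q

counts : ℕ → ℕ → List ℕ → List ℕ
counts a zero L = []
counts a (suc m) L = countEq a L ∷ counts (suc a) m L

length-counts : ∀ a m L → length (counts a m L) ≡ m
length-counts a zero L = refl
length-counts a (suc m) L = cong suc (length-counts (suc a) m L)

counts-applyUpTo : ∀ {f a} m L → (∀ i → f i ≡ a + i) →
  map (λ i → countEq i L) (applyUpTo f m) ≡ counts a m L
counts-applyUpTo zero L _ = refl
counts-applyUpTo {f} {a} (suc m) L f≗a+ =
  cong₂ _∷_ (cong (λ c → countEq c L) (trans (f≗a+ 0) (+-identityʳ a)))
            (counts-applyUpTo m L (λ i → trans (f≗a+ (suc i)) (+-suc a i)))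

qs≡counts : ∀ {n} (v : Vec ℕ n) → qs v ≡ counts 1 n (toList v)
qs≡counts {n} v = counts-applyUpTo n (toList v) (λ _ → refl)

length-qs : ∀ {n} (v : Vec ℕ n) → length (qs v) ≡ n
length-qs {n} v = trans (length-map _ (applyUpTo suc n)) (length-applyUpTo suc n)

countEq-∷-≡ : ∀ a L → countEq a (a ∷ L) ≡ suc (countEq a L)
countEq-∷-≡ a L with a ≟ a
... | yes _ = refl
... | no a≢a = contradiction refl a≢a

countEq-∷-≢ : ∀ {c x} L → c ≢ x → countEq c (x ∷ L) ≡ countEq c L
countEq-∷-≢ {c} {x} L c≢x with c ≟ x
... | yes c≡x = contradiction c≡x c≢x
... | no _ = refl

counts-∷-< : ∀ {x a} m L → x < a → counts a m (x ∷ L) ≡ counts a m L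
counts-∷-< zero L _ = refl
counts-∷-< (suc m) L x<a =
  cong₂ _∷_ (countEq-∷-≢ L (>⇒≢ x<a)) (counts-∷-< m L (m<n⇒m<1+n x<a))

counts-∷ : ∀ {x a} m L → a ≤ x → counts a m (x ∷ L) ≡ incAt (x ∸ a) (counts a m L)
counts-∷ zero L _ = refl
counts-∷ {x} {a} (suc m) L a≤x with m≤n⇒m<n∨m≡n a≤x
... | inj₂ refl = begin
  countEq a (a ∷ L) ∷ counts (suc a) m (a ∷ L)
    ≡⟨ cong₂ _∷_ (countEq-∷-≡ a L) (counts-∷-< m L ≤-refl) ⟩
  suc (countEq a L) ∷ counts (suc a) m L
    ≡⟨ cong (λ i → incAt i (counts a (suc m) L)) (n∸n≡0 a) ⟨
  incAt (a ∸ a) (counts a (suc m) L) ∎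
... | inj₁ a<x = begin
  countEq a (x ∷ L) ∷ counts (suc a) m (x ∷ L)
    ≡⟨ cong₂ _∷_ (countEq-∷-≢ L (<⇒≢ a<x)) (counts-∷ m L a<x) ⟩
  countEq a L ∷ incAt (x ∸ suc a) (counts (suc a) m L)
    ≡⟨ cong (λ i → incAt i (counts a (suc m) L)) (+-∸-assoc 1 a<x) ⟨
  incAt (x ∸ a) (counts a (suc m) L) ∎

ballot-counts-[] : ∀ a p → Ballot (suc p) (counts a p [] ++ 0 ∷ [])
ballot-counts-[] a zero = refl
ballot-counts-[] a (suc p) = ballot-counts-[] (suc a) p

-- InNb v is InNbFrom 0 v definitionally.
InNbFrom : ℕ → ∀ {n} → Vec ℕ n → Set
InNbFrom p v = ∀ i → 0 < lookup v i × lookup v i ≤ suc (p + toℕ i)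

Bounded : ℕ → List ℕ → Set
Bounded p [] = ⊤
Bounded p (x ∷ L) = (0 < x × x ≤ suc p) × Bounded (suc p) L

InNbFrom⇒Bounded : ∀ {p n} (v : Vec ℕ n) → InNbFrom p v → Bounded p (toList v)
InNbFrom⇒Bounded [] _ = tt
InNbFrom⇒Bounded {p} (x ∷ v) v∈ =
  map₂ (subst (λ j → x ≤ suc j) (+-identityʳ p)) (v∈ fzero) ,
  InNbFrom⇒Bounded v (λ i → map₂ (subst (λ j → lookup v i ≤ suc j) (+-suc p (toℕ i))) (v∈ (fsuc i)))

Bounded⇒InNbFrom : ∀ {p n} (v : Vec ℕ n) → Bounded p (toList v) → InNbFrom p v
Bounded⇒InNbFrom {p} (x ∷ _) (x∈ , _) fzero = map₂ (subst (λ j → x ≤ suc j) (sym (+-identityʳ p))) x∈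
Bounded⇒InNbFrom {p} (_ ∷ v) (_ , v∈) (fsuc i) =
  map₂ (subst (λ j → lookup v i ≤ suc j) (sym (+-suc p (toℕ i)))) (Bounded⇒InNbFrom v v∈ i)

-- Each entry x of L adds one at position x − 1, which is below the counter p + 1 since x ≤ p + 1.
ballot-counts : ∀ {p} L → Bounded p L → Ballot (suc p) (counts 1 (p + length L) L ++ 0 ∷ [])
ballot-counts {p} [] _ =
  subst (λ m → Ballot (suc p) (counts 1 m [] ++ 0 ∷ [])) (sym (+-identityʳ p)) (ballot-counts-[] 1 p)
ballot-counts {p} (x ∷ L) ((0<x , x≤1+p) , L∈) =
  subst (Ballot (suc p)) (sym eq) (ballot-incAt (C ++ 0 ∷ []) x∸1<1+p (ballot-counts L L∈))
  where
  C : List ℕ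
  C = counts 1 (suc p + length L) L
  x∸1<1+p : x ∸ 1 < suc p
  x∸1<1+p = s≤s (∸-monoˡ-≤ 1 x≤1+p)
  x∸1<|C| : x ∸ 1 < length C
  x∸1<|C| = subst (x ∸ 1 <_) (sym (length-counts 1 _ L)) (<-≤-trans x∸1<1+p (m≤m+n (suc p) (length L)))
  eq : counts 1 (p + suc (length L)) (x ∷ L) ++ 0 ∷ [] ≡ incAt (x ∸ 1) (C ++ 0 ∷ [])
  eq = begin
    counts 1 (p + suc (length L)) (x ∷ L) ++ 0 ∷ []
      ≡⟨ cong (λ m → counts 1 m (x ∷ L) ++ 0 ∷ []) (+-suc p (length L)) ⟩
    counts 1 (suc p + length L) (x ∷ L) ++ 0 ∷ []
      ≡⟨ cong (_++ 0 ∷ []) (counts-∷ _ L 0<x) ⟩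
    incAt (x ∸ 1) C ++ 0 ∷ []
      ≡⟨ incAt-++ˡ C _ x∸1<|C| ⟨
    incAt (x ∸ 1) (C ++ 0 ∷ []) ∎

ballot-qs : ∀ {n} (v : Vec ℕ n) → InNb v → Ballot 1 (qs v ++ 0 ∷ [])
ballot-qs v v∈Nb =
  subst (λ q → Ballot 1 (q ++ 0 ∷ [])) counts≡qs (ballot-counts (toList v) (InNbFrom⇒Bounded v v∈Nb))
  where
  counts≡qs : counts 1 (length (toList v)) (toList v) ≡ qs v
  counts≡qs = trans (cong (λ m → counts 1 m (toList v)) (length-toList v)) (sym (qs≡counts v))

fromMultiplicities : ℕ → List ℕ → List ℕ
fromMultiplicities a [] = []
fromMultiplicities a (y ∷ q) = replicate y a ++ fromMultiplicities (suc a) q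

length-fromMultiplicities : ∀ a q → length (fromMultiplicities a q) ≡ sum q
length-fromMultiplicities a [] = refl
length-fromMultiplicities a (y ∷ q) =
  trans (length-++ (replicate y a)) (cong₂ _+_ (length-replicate y) (length-fromMultiplicities (suc a) q))

fromMultiplicities-∷ʳ-0 : ∀ a q → fromMultiplicities a (q ++ 0 ∷ []) ≡ fromMultiplicities a q
fromMultiplicities-∷ʳ-0 a [] = refl
fromMultiplicities-∷ʳ-0 a (y ∷ q) = cong (replicate y a ++_) (fromMultiplicities-∷ʳ-0 (suc a) q)

countEq-replicate-≡ : ∀ a y G → countEq a (replicate y a ++ G) ≡ y + countEq a G
countEq-replicate-≡ a zero G = refl
countEq-replicate-≡ a (suc y) G = trans (countEq-∷-≡ a _) (cong suc (countEq-replicate-≡ a y G))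

countEq-replicate-≢ : ∀ {c a} y G → c ≢ a → countEq c (replicate y a ++ G) ≡ countEq c G
countEq-replicate-≢ zero G _ = refl
countEq-replicate-≢ (suc y) G c≢a = trans (countEq-∷-≢ _ c≢a) (countEq-replicate-≢ y G c≢a)

countEq-fromMultiplicities-< : ∀ {c a} q → c < a → countEq c (fromMultiplicities a q) ≡ 0
countEq-fromMultiplicities-< [] _ = refl
countEq-fromMultiplicities-< (y ∷ q) c<a =
  trans (countEq-replicate-≢ y _ (<⇒≢ c<a)) (countEq-fromMultiplicities-< q (m<n⇒m<1+n c<a))

counts-replicate-< : ∀ {x a} m y G → x < a → counts a m (replicate y x ++ G) ≡ counts a m G
counts-replicate-< m zero G _ = refl
counts-replicate-< m (suc y) G x<a = trans (counts-∷-< m _ x<a) (counts-replicate-< m y G x<a)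

counts-fromMultiplicities : ∀ a q → counts a (length q) (fromMultiplicities a q) ≡ q
counts-fromMultiplicities a [] = refl
counts-fromMultiplicities a (y ∷ q) = cong₂ _∷_
  (begin
    countEq a (replicate y a ++ rest)  ≡⟨ countEq-replicate-≡ a y rest ⟩
    y + countEq a rest                 ≡⟨ cong (y +_) (countEq-fromMultiplicities-< q ≤-refl) ⟩
    y + 0                              ≡⟨ +-identityʳ y ⟩
    y                                  ∎)
  (trans (counts-replicate-< (length q) y rest ≤-refl) (counts-fromMultiplicities (suc a) q))
  where
  rest : List ℕ
  rest = fromMultiplicities (suc a) q

bounded-replicate : ∀ {a p} y G → a ≤ p → Bounded (y + p) G → Bounded p (replicate y (suc a) ++ G)
bounded-replicate zero G _ G∈ = G∈
bounded-replicate {p = p} (suc y) G a≤p G∈ =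
  (s≤s z≤n , s≤s a≤p) ,
  bounded-replicate y G (m≤n⇒m≤1+n a≤p) (subst (λ j → Bounded j G) (sym (+-suc y p)) G∈)

-- The invariant k + a ≡ p + 1 ties the Ballot counter to the next letter and its position.
ballot⇒bounded : ∀ {k a p} q → Ballot k q → k + a ≡ suc p → Bounded p (fromMultiplicities (suc a) q)
ballot⇒bounded [] _ _ = tt
ballot⇒bounded {zero} (_ ∷ _) ()
ballot⇒bounded {suc k} {a} {p} (y ∷ q) bal k+a≡1+p =
  bounded-replicate y _ (subst (a ≤_) k+a≡p (m≤n+m a k)) (ballot⇒bounded q bal invariant)
  where
  k+a≡p : k + a ≡ p
  k+a≡p = suc-injective k+a≡1+p
  invariant : y + k + suc a ≡ suc (y + p)
  invariant = begin
    y + k + suc a      ≡⟨ +-suc (y + k) a ⟩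
    suc (y + k + a)    ≡⟨ cong suc (+-assoc y k a) ⟩
    suc (y + (k + a))  ≡⟨ cong (λ j → suc (y + j)) k+a≡p ⟩
    suc (y + p)        ∎

toList-of-length : ∀ {n} (L : List ℕ) → length L ≡ n → Σ (Vec ℕ n) λ v → toList v ≡ L
toList-of-length L refl = fromList L , toList∘fromList L

ballot⇒qs : ∀ {n} q → Ballot 1 (q ++ 0 ∷ []) → length (q ++ 0 ∷ []) ≡ suc n →
  Σ (Vec ℕ n) λ v → InNb v × qs v ≡ q
ballot⇒qs {n} q bal len = v , Bounded⇒InNbFrom v (subst (Bounded 0) (sym v≡w) w∈) , qs≡q
  where
  w : List ℕ
  w = fromMultiplicities 1 q
  w∈ : Bounded 0 w
  w∈ = subst (Bounded 0) (fromMultiplicities-∷ʳ-0 1 q) (ballot⇒bounded (q ++ 0 ∷ []) bal refl)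
  |w|≡n : length w ≡ n
  |w|≡n = begin
    length w                                     ≡⟨ cong length (fromMultiplicities-∷ʳ-0 1 q) ⟨
    length (fromMultiplicities 1 (q ++ 0 ∷ []))  ≡⟨ length-fromMultiplicities 1 (q ++ 0 ∷ []) ⟩
    sum (q ++ 0 ∷ [])                            ≡⟨ suc-injective (trans (ballot-sum (q ++ 0 ∷ []) bal) len) ⟩
    n                                            ∎
  v : Vec ℕ n
  v = proj₁ (toList-of-length w |w|≡n)
  v≡w : toList v ≡ w
  v≡w = proj₂ (toList-of-length w |w|≡n)
  qs≡q : qs v ≡ q
  qs≡q = begin
    qs v                   ≡⟨ qs≡counts v ⟩
    counts 1 n (toList v)  ≡⟨ cong₂ (counts 1) (suc-injective (trans (sym (length-∷ʳ q)) len)) (sym v≡w) ⟨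
    counts 1 (length q) w  ≡⟨ counts-fromMultiplicities 1 q ⟩
    q                      ∎

proposition3p1 : (n : ℕ) → 1 ≤ n →
    ((v : Vec ℕ n) → InNb v →
      ∃! _≡_ (λ (t : Y n) → leftParens t ≡ qs v ++ (0 ∷ [])))
    × ((t : Y n) → Σ (Vec ℕ n) (λ v → InNb v × leftParens t ≡ qs v ++ (0 ∷ [])))
proposition3p1 n _ = existsUnique , surjective
  where
  existsUnique : (v : Vec ℕ n) → InNb v → ∃! _≡_ (λ (t : Y n) → leftParens t ≡ qs v ++ 0 ∷ [])
  existsUnique v v∈Nb
    with t , t↦q ← ballot⇒tree _ (ballot-qs v v∈Nb) (trans (length-∷ʳ (qs v)) (cong suc (length-qs v)))
    = t , t↦q , λ t′↦q → leftParens-injective (trans t↦q (sym t′↦q))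
  surjective : (t : Y n) → Σ (Vec ℕ n) (λ v → InNb v × leftParens t ≡ qs v ++ 0 ∷ [])
  surjective t
    with q , t↦q ← leftParens-∷ʳ-0 t
    with v , v∈Nb , qs≡q ← ballot⇒qs q (subst (Ballot 1) (trans (++-identityʳ _) t↦q) (ballot-leftParens t refl))
                                        (trans (cong length (sym t↦q)) (length-leftParens t))
    = v , v∈Nb , trans t↦q (cong (_++ 0 ∷ []) (sym qs≡q))
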